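{- Let $P$ and $Q$ be autarkic tuples. Then $P\subseteq Q$, or $Q\subseteq P$, or $P\cap Q=\emptyset$.
   Context: Steiner Forest: an undirected graph $G=(V,E)$ with nonnegative edge costs $c_e$ and a set of demand pairs $\{a,b\}\subseteq V$; vertices of a demand pair are partners. For $U\subseteq V$, $\delta(U)$ is the set of edges with exactly one endpoint in $U$, and $\mathrm{sep}(U)$ the set of demand pairs $\{a,b\}$ with $|\{a,b\}\cap U|=1$. $\varepsilon$-extended moat-growing algorithm (fixed $\varepsilon\ge0$): time $t$ increases from $0$; it maintains $y_S(t)\ge0$ for all $S\subseteq V$, initially $0$; an edge $e$ is tight if $\sum_{S:e\in\delta(S)}y_S(t)=c_e$; $F$ is the set of tight edges and $\mathcal C^t$ the vertex sets of components of $(V,F)$. Each component has a budget (each vertex initially $0$). A component is demand-active if it contains a vertex not yet connected in $(V,F)$ to one of its partners, budget-active if not demand-active but with positive budget, active if either; $\mathcal A^t$ is the set of active components. Each $y_S$, $S\in\mathcal A^t$, grows at unit rate; budgets of demand-active components grow at rate $\varepsilon$, those of budget-active components decrease at unit rate; newly tight edges join $F$ and merged components' budgets are summed. $y_S=y_S(\infty)$. Autarkic pair: $\{A,B\}$ with $A,B\in\mathrm{supp}(y)$ disjoint, both in $\mathcal A^t$ for some $t$, and $\mathrm{sep}(A)=\mathrm{sep}(B)\ne\emptyset$. Autarkic triple: $\{A_1,A_2,A_3\}$ pairwise disjoint, all in $\mathcal A^t$ for some $t$, each $\mathrm{sep}(A_i)\ne\emptyset$, and $\mathrm{sep}(A_1\cup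 A_2\cup A_3)=\emptyset$. Autarkic tuples are autarkic pairs and triples. For autarkic tuples $P$ and $Q$, write $P\subseteq Q$ if every set of $P$ is contained in some set of $Q$, and $P\cap Q=\emptyset$ if every set of $P$ is disjoint from every set of $Q$.
   Formalization: The edge costs $c_e$ and the parameter $\varepsilon$ are nonnegative rationals, so the times $t$ and the values $y_S(t)$ are rational too. -}

module Defs where

open import Data.Nat using (ℕ; zero; suc) renaming (_<_ to _<ℕ_)
open import Data.Fin using (Fin)
open import Data.Fin.Subset using (Subset; _∈_; _⊆_; _∪_)
open import Data.Fin.Subset.Properties using (_⊆?_)
open import Data.Bool using (Bool; true; false; if_then_else_; _xor_)
open import Data.Vec using (Vec; []; _∷_; lookup; map)
open import Data.List using (List; []; _∷_; _++_; foldr) renaming (map to mapL)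
open import Data.List.Relation.Unary.Any using (Any)
open import Data.List.Relation.Unary.All using (All)
open import Data.Product using (Σ; ∃; _×_; _,_)
open import Data.Sum using (_⊎_)
open import Data.Empty using (⊥)
open import Relation.Nullary using (¬_; does)
open import Relation.Binary.PropositionalEquality using (_≡_; _≢_)
open import Relation.Binary.Construct.Closure.ReflexiveTransitive using (Star)
open import Data.Rational using (ℚ; 0ℚ; 1ℚ; _+_; _*_; _-_; _≤_; _<_)

allSubsets : (n : ℕ) → List (Subset n)
allSubsets zero    = [] ∷ []
allSubsets (suc n) = mapL (true ∷_) (allSubsets n) ++ mapL (false ∷_) (allSubsets n)

sumℚ : List ℚ → ℚ
sumℚ = foldr _+_ 0ℚ

ΣS : {n : ℕ} → (Subset n → ℚ) → ℚ
ΣS {n} f = sumℚ (mapL f (allSubsets n))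

Disjoint : {n : ℕ} → Subset n → Subset n → Set
Disjoint A B = ∀ v → v ∈ A → v ∈ B → ⊥

-- Steiner forest instance (simple undirected graph on V = Fin n)

record Instance : Set where
  field
    n      : ℕ
    E      : Fin n → Fin n → Bool          -- adjacency: {u,v} ∈ E iff E u v ≡ true
    E-sym  : ∀ u v → E u v ≡ E v u
    E-irr  : ∀ v → E v v ≡ false
    c      : Fin n → Fin n → ℚ
    c-sym  : ∀ u v → c u v ≡ c v u
    c-nonneg : ∀ u v → 0ℚ ≤ c u v
    D      : List (Fin n × Fin n)
    D-ne   : All (λ d → Σ.proj₁ d ≢ Σ.proj₂ d) D
    ε      : ℚ
    ε-nonneg : 0ℚ ≤ ε

module _ (I : Instance) where
  open Instance I

  V = Fin n

  sepd : Subset n → Fin n × Fin n → Bool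
  sepd U (a , b) = lookup U a xor lookup U b

  SameSep : Subset n → Subset n → Set
  SameSep A B = All (λ d → sepd A d ≡ sepd B d) D

  SepNonEmpty : Subset n → Set
  SepNonEmpty A = Any (λ d → sepd A d ≡ true) D

  SepEmpty : Subset n → Set
  SepEmpty A = All (λ d → sepd A d ≡ false) D

  -- The state at a time t is given by two functions ya yb : Subset n → ℚ,
  -- where ya S (resp. yb S) is the total time during which S was a
  -- demand-active (resp. budget-active) component, so y_S = ya S + yb S.

  module AtState (ya yb : Subset n → ℚ) where

    y : Subset n → ℚ
    y S = ya S + yb S

    load : Fin n → Fin n → ℚ
    load u v = ΣS (λ S → if sepd S (u , v) then y S else 0ℚ)

    Tight : Fin n → Fin n → Set
    Tight u v = (E u v ≡ true) × (load u v ≡ c u v)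

    Conn : Fin n → Fin n → Set
    Conn = Star Tight

    IsComponent : Subset n → Set
    IsComponent C = ∃ λ v → ∀ u → ((u ∈ C → Conn v u) × (Conn v u → u ∈ C))

    -- budget of a component C: the budgets of all (earlier) components
    -- contained in C, which were merged into C, summed up; a set S
    -- contributed ε per unit time while demand-active and -1 per unit
    -- time while budget-active.
    budget : Subset n → ℚ
    budget C = ΣS (λ S → if does (S ⊆? C) then ((ε * ya S) - yb S) else 0ℚ)

    HasUnconnected : Subset n → Set
    HasUnconnected C =
      Any (λ { (a , b) → ((a ∈ C) × ¬ Conn a b) ⊎ ((b ∈ C) × ¬ Conn b a) }) D

    DemandActive : Subset n → Set
    DemandActive C = IsComponent C × HasUnconnected C

    BudgetActive : Subset n → Set
    BudgetActive C = IsComponent C × ¬ HasUnconnected C × (0ℚ < budget C)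

    Active : Subset n → Set
    Active C = DemandActive C ⊎ BudgetActive C

    -- (ra, rb) are the (right) growth rates of (ya, yb) prescribed by the
    -- algorithm at this state
    HasRates : (Subset n → ℚ) → (Subset n → ℚ) → Set
    HasRates ra rb = ∀ S →
        (DemandActive S → (ra S ≡ 1ℚ) × (rb S ≡ 0ℚ))
      × (BudgetActive S → (ra S ≡ 0ℚ) × (rb S ≡ 1ℚ))
      × (¬ Active S → (ra S ≡ 0ℚ) × (rb S ≡ 0ℚ))

  -- A (terminating) run of the ε-extended moat-growing algorithm:
  -- piecewise linear evolution with breakpoints 0 = ts 0 < … < ts k;
  -- on [ts i, ts (i+1)) the right derivative is the rate prescribed by the
  -- algorithm at the current state; after ts k nothing is active.

  zeroF : Subset n → ℚ
  zeroF _ = 0ℚ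

  record Run : Set where
    field
      k      : ℕ
      ts     : ℕ → ℚ
      ya yb  : ℚ → Subset n → ℚ
      ra rb  : ℕ → Subset n → ℚ
      ts-zero : ts 0 ≡ 0ℚ
      ts-incr : ∀ i → i <ℕ k → ts i < ts (suc i)
      init-a  : ∀ S → ya 0ℚ S ≡ 0ℚ
      init-b  : ∀ S → yb 0ℚ S ≡ 0ℚ
      lin-a   : ∀ i → i <ℕ k → ∀ t → ts i ≤ t → t ≤ ts (suc i) → ∀ S →
                  ya t S ≡ ya (ts i) S + (t - ts i) * ra i S
      lin-b   : ∀ i → i <ℕ k → ∀ t → ts i ≤ t → t ≤ ts (suc i) → ∀ S →
                  yb t S ≡ yb (ts i) S + (t - ts i) * rb i S
      rates   : ∀ i → i <ℕ k → ∀ t → ts i ≤ t → t < ts (suc i) →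
                  AtState.HasRates (ya t) (yb t) (ra i) (rb i)
      final-a : ∀ t → ts k ≤ t → ∀ S → ya t S ≡ ya (ts k) S
      final-b : ∀ t → ts k ≤ t → ∀ S → yb t S ≡ yb (ts k) S
      final-rates : AtState.HasRates (ya (ts k)) (yb (ts k)) zeroF zeroF

    ActiveAt : ℚ → Subset n → Set
    ActiveAt t = AtState.Active (ya t) (yb t)

    yFinal : Subset n → ℚ
    yFinal S = ya (ts k) S + yb (ts k) S

    InSupp : Subset n → Set
    InSupp S = 0ℚ < yFinal S

    AllActiveSometime : List (Subset n) → Set
    AllActiveSometime Xs = ∃ λ t → (0ℚ ≤ t) × All (ActiveAt t) Xs

  data Tuple : Set where
    pair   : Subset n → Subset n → Tuple
    triple : Subset n → Subset n → Subset n → Tuple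

  members : Tuple → List (Subset n)
  members (pair A B)         = A ∷ B ∷ []
  members (triple A₁ A₂ A₃)  = A₁ ∷ A₂ ∷ A₃ ∷ []

  module _ (R : Run) where
    open Run R

    AutarkicPair : Subset n → Subset n → Set
    AutarkicPair A B =
      InSupp A × InSupp B × Disjoint A B
      × AllActiveSometime (A ∷ B ∷ [])
      × SameSep A B × SepNonEmpty A

    AutarkicTriple : Subset n → Subset n → Subset n → Set
    AutarkicTriple A₁ A₂ A₃ =
      Disjoint A₁ A₂ × Disjoint A₁ A₃ × Disjoint A₂ A₃
      × AllActiveSometime (A₁ ∷ A₂ ∷ A₃ ∷ [])
      × SepNonEmpty A₁ × SepNonEmpty A₂ × SepNonEmpty A₃
      × SepEmpty (A₁ ∪ (A₂ ∪ A₃))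

    Autarkic : Tuple → Set
    Autarkic (pair A B)        = AutarkicPair A B
    Autarkic (triple A₁ A₂ A₃) = AutarkicTriple A₁ A₂ A₃

  _⊆T_ : Tuple → Tuple → Set
  P ⊆T Q = All (λ X → Any (λ Y → X ⊆ Y) (members Q)) (members P)

  DisjointT : Tuple → Tuple → Set
  DisjointT P Q = All (λ X → All (λ Y → Disjoint X Y) (members Q)) (members P)

{-# OPTIONS --safe #-}
-- A set crossing a tight edge is not a component, so it is never active and
-- its y-value is frozen: tight edges stay tight.  Hence components at an
-- earlier time refine the components at any later time, and every member of
-- a tuple P active at time t_P lies inside a member of a tuple Q active at
-- t_Q ≥ t_P or is disjoint from all of them.  The union of an autarkic tuple
-- separates no demand pair, while splitting an autarkic tuple into one member
-- A and the union B of the others always gives sep(A) = sep(B) ≠ ∅.  So if the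
-- union of Q contained A but missed B, a demand pair would cross it; therefore
-- the members of P lie all inside or all outside the members of Q.

module Submission where

open import Defs
open import Algebra.Bundles using (CommutativeMonoid; CommutativeRing)
import Algebra.Properties.CommutativeSemigroup as CommutativeSemigroupProperties
open import Data.Bool using (true; false; _∨_; _xor_; if_then_else_)
open import Data.Bool.Properties using (xor-comm; xor-same; ¬-not; xor-∧-commutativeRing)
open import Data.Empty using (⊥; ⊥-elim)
open import Data.Fin using (Fin)
open import Data.Fin.Subset using (Subset; _∈_; _∉_; _⊆_; _∪_; ⋃)
open import Data.Fin.Subset.Properties
  using (_∈?_; x∈p∪q⁻; p⊆p∪q; q⊆p∪q; ∉⊥; ∪-identityʳ; ∪-commutativeMonoid)
open import Data.List using (List; []; _∷_)
open import Data.List.Properties using (map-cong)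
open import Data.List.Relation.Unary.All as All using (All; []; _∷_; lookupWith)
open import Data.List.Relation.Unary.Any using (Any; here; there)
open import Data.Nat using (ℕ; suc; _≤‴_; ≤‴-refl; ≤‴-step) renaming (_<_ to _<ℕ_)
open import Data.Nat.Properties using (0≤‴n; ≤‴⇒≤)
open import Data.Product using (∃; _×_; _,_; proj₁; proj₂)
open import Data.Rational using (ℚ; 0ℚ; _+_; _*_; _-_; _≤_; _<_)
open import Data.Rational.Properties
  using (≤-refl; ≤-trans; <⇒≤; ≤-total; _≤?_; ≰⇒>; *-zeroʳ; +-identityʳ)
open import Data.Sum using (_⊎_; inj₁; inj₂; [_,_]′)
import Data.Sum as Sum
open import Data.Vec using (lookup)
open import Data.Vec.Properties using (lookup⇒[]=; []=⇒lookup; lookup-zipWith)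
open import Function using (_∘_; case_of_)
open import Relation.Binary.Construct.Closure.ReflexiveTransitive as Star using (ε; _◅_; _◅◅_)
open import Relation.Binary.PropositionalEquality
  using (_≡_; refl; sym; trans; cong; cong₂; subst; module ≡-Reasoning)
open import Relation.Nullary using (¬_; yes; no)

private
  variable
    m : ℕ
    A B C U X S A₁ A₂ A₃ : Subset m
    Ys : List (Subset m)
    a b u v : Fin m

All∧Any⇒Any : ∀ {T : Set} {P Q R : T → Set} {xs : List T} →
              (∀ {x} → P x → Q x → R x) → All P xs → Any Q xs → Any R xs
All∧Any⇒Any f (px ∷ _)   (here qx)  = here (f px qx)
All∧Any⇒Any f (_  ∷ pxs) (there qx) = there (All∧Any⇒Any f pxs qx)

All-swap : ∀ {T T′ : Set} {R : T → T′ → Set} {xs : List T} {ys : List T′} →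
           All (λ x → All (R x) ys) xs → All (λ y → All (λ x → R x y) xs) ys
All-swap {ys = []}     _   = []
All-swap {ys = _ ∷ _}  rss = All.map All.head rss ∷ All-swap (All.map All.tail rss)

ΣS-cong : {f g : Subset m → ℚ} → (∀ S → f S ≡ g S) → ΣS f ≡ ΣS g
ΣS-cong {m} f≗g = cong sumℚ (map-cong f≗g (allSubsets m))

Disjoint-sym : Disjoint A B → Disjoint B A
Disjoint-sym A#B v v∈B v∈A = A#B v v∈A v∈B

disjoint-∪ : Disjoint A B → Disjoint A C → Disjoint A (B ∪ C)
disjoint-∪ {B = B} {C = C} A#B A#C v v∈A v∈B∪C =
  [ A#B v v∈A , A#C v v∈A ]′ (x∈p∪q⁻ B C v∈B∪C)

∪-disjoint : Disjoint A U → Disjoint B U → Disjoint (A ∪ B) U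
∪-disjoint A#U B#U = Disjoint-sym (disjoint-∪ (Disjoint-sym A#U) (Disjoint-sym B#U))

∪-⊆ : A ⊆ U → B ⊆ U → A ∪ B ⊆ U
∪-⊆ {A = A} {B = B} A⊆U B⊆U v∈A∪B = [ A⊆U , B⊆U ]′ (x∈p∪q⁻ A B v∈A∪B)

⊆-⋃ : Any (X ⊆_) Ys → X ⊆ ⋃ Ys
⊆-⋃ {Ys = _ ∷ Ys} (here X⊆Y)    v∈X = p⊆p∪q (⋃ Ys) (X⊆Y v∈X)
⊆-⋃ {Ys = Y ∷ Ys} (there X⊆⋃Ys) v∈X = q⊆p∪q Y (⋃ Ys) (⊆-⋃ X⊆⋃Ys v∈X)

disjoint-⋃ : All (Disjoint X) Ys → Disjoint X (⋃ Ys)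
disjoint-⋃ []            _ _ v∈∅ = ∉⊥ v∈∅
disjoint-⋃ (X#Y ∷ X#Ys) = disjoint-∪ X#Y (disjoint-⋃ X#Ys)

∉⇒lookup : v ∉ S → lookup S v ≡ false
∉⇒lookup {v = v} {S = S} v∉S = ¬-not (v∉S ∘ lookup⇒[]= v S)

lookup-∪ : Disjoint A B → ∀ v → lookup (A ∪ B) v ≡ lookup A v xor lookup B v
lookup-∪ {A = A} {B = B} A#B v
  rewrite lookup-zipWith _∨_ v A B
  with lookup A v in v∈A | lookup B v in v∈B
... | true  | true  = ⊥-elim (A#B v (lookup⇒[]= v A v∈A) (lookup⇒[]= v B v∈B))
... | true  | false = refl
... | false | _     = refl

xor≡false⇒≡ : ∀ {x y} → x xor y ≡ false → x ≡ y
xor≡false⇒≡ {false} {false} _ = refl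
xor≡false⇒≡ {true}  {true}  _ = refl

module Separation (I : Instance) where
  open Instance I using (n)

  open CommutativeSemigroupProperties
    (CommutativeMonoid.commutativeSemigroup (CommutativeRing.+-commutativeMonoid xor-∧-commutativeRing))
    using (interchange)

  sepd-swap : ∀ S a b → sepd I S (a , b) ≡ sepd I S (b , a)
  sepd-swap S a b = xor-comm (lookup S a) (lookup S b)

  sepd-true⁺ : a ∈ S → b ∉ S → sepd I S (a , b) ≡ true
  sepd-true⁺ a∈S b∉S rewrite []=⇒lookup a∈S | ∉⇒lookup b∉S = refl

  sepd-true⁻ : sepd I S (a , b) ≡ true → a ∉ S → b ∈ S
  sepd-true⁻ {S = S} {a = a} {b = b} sep a∉S =
    lookup⇒[]= b S (trans (cong (_xor lookup S b) (sym (∉⇒lookup a∉S))) sep)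

  sepd-true-endpoint : sepd I S (a , b) ≡ true → a ∈ S ⊎ b ∈ S
  sepd-true-endpoint {S = S} {a = a} sep with a ∈? S
  ... | yes a∈S = inj₁ a∈S
  ... | no  a∉S = inj₂ (sepd-true⁻ sep a∉S)

  sepd-false⁺ : (a ∈ S → b ∈ S) → (b ∈ S → a ∈ S) → sepd I S (a , b) ≡ false
  sepd-false⁺ {a = a} {S = S} a⇒b b⇒a with a ∈? S
  ... | yes a∈S rewrite []=⇒lookup a∈S | []=⇒lookup (a⇒b a∈S) = refl
  ... | no  a∉S rewrite ∉⇒lookup a∉S | ∉⇒lookup (a∉S ∘ b⇒a) = refl

  sepd-∪ : Disjoint A B → ∀ d → sepd I (A ∪ B) d ≡ sepd I A d xor sepd I B d
  sepd-∪ {A = A} {B = B} A#B (a , b) = begin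
    lookup (A ∪ B) a xor lookup (A ∪ B) b
      ≡⟨ cong₂ _xor_ (lookup-∪ A#B a) (lookup-∪ A#B b) ⟩
    (lookup A a xor lookup B a) xor (lookup A b xor lookup B b)
      ≡⟨ interchange (lookup A a) (lookup B a) (lookup A b) (lookup B b) ⟩
    (lookup A a xor lookup A b) xor (lookup B a xor lookup B b) ∎
    where open ≡-Reasoning

  SameSep⇒SepEmpty-∪ : Disjoint A B → SameSep I A B → SepEmpty I (A ∪ B)
  SameSep⇒SepEmpty-∪ {A = A} {B = B} A#B = All.map λ {d} A≡B →
    trans (sepd-∪ A#B d) (trans (cong (_xor sepd I B d) A≡B) (xor-same (sepd I B d)))

  SepEmpty-∪⇒SameSep : Disjoint A B → SepEmpty I (A ∪ B) → SameSep I A B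
  SepEmpty-∪⇒SameSep A#B = All.map λ {d} A∪B≡false →
    xor≡false⇒≡ (trans (sym (sepd-∪ A#B d)) A∪B≡false)

  SepEmpty⇒¬SepNonEmpty : SepEmpty I U → ¬ SepNonEmpty I U
  SepEmpty⇒¬SepNonEmpty = lookupWith λ { f t → case trans (sym f) t of λ () }

  SepTwins : Subset n → Subset n → Set
  SepTwins A B = Disjoint A B × SameSep I A B × SepNonEmpty I A

  SepTwins-sym : SepTwins A B → SepTwins B A
  SepTwins-sym (A#B , A≡B , A-sep) =
    Disjoint-sym A#B , All.map sym A≡B , All∧Any⇒Any (λ A≡B A-sep → trans (sym A≡B) A-sep) A≡B A-sep

  sepTwins-straddle : SepTwins A B → A ⊆ U → Disjoint B U → SepNonEmpty I U
  sepTwins-straddle {A = A} {B = B} {U = U} (A#B , A≡B , A-sep) A⊆U B#U =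
    All∧Any⇒Any crossing A≡B A-sep
    where
    crossing-from : a ∈ A → sepd I B (a , b) ≡ true → sepd I U (a , b) ≡ true
    crossing-from {a} a∈A B-sep = sepd-true⁺ (A⊆U a∈A) (B#U _ (sepd-true⁻ B-sep (A#B a a∈A)))

    crossing : ∀ {d} → sepd I A d ≡ sepd I B d → sepd I A d ≡ true → sepd I U d ≡ true
    crossing {a , b} A≡B A-sep with sepd-true-endpoint A-sep
    ... | inj₁ a∈A = crossing-from a∈A (trans (sym A≡B) A-sep)
    ... | inj₂ b∈A = trans (sepd-swap U a b)
          (crossing-from b∈A (trans (sepd-swap B b a) (trans (sym A≡B) A-sep)))

  twins-not-split : SepEmpty I U → SepTwins A B → A ⊆ U → Disjoint B U → ⊥
  twins-not-split {U = U} U-closed twins A⊆U B#U =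
    SepEmpty⇒¬SepNonEmpty {U = U} U-closed (sepTwins-straddle twins A⊆U B#U)

  triple-twins : Disjoint A B → Disjoint A C → SepEmpty I (A ∪ (B ∪ C)) → SepNonEmpty I A →
                 SepTwins A (B ∪ C)
  triple-twins {A = A} {B = B} {C = C} A#B A#C closed A-sep =
    A#B∪C , SepEmpty-∪⇒SameSep A#B∪C closed , A-sep
    where
    A#B∪C : Disjoint A (B ∪ C)
    A#B∪C = disjoint-∪ A#B A#C

module StateProperties (I : Instance) (ya yb : Subset (Instance.n I) → ℚ) where
  open Instance I using (E-sym; c-sym)
  open AtState I ya yb
  open Separation I using (sepd-swap; sepd-false⁺)

  Tight-sym : Tight u v → Tight v u
  Tight-sym {u = u} {v = v} (uv∈E , tight) =
    trans (E-sym v u) uv∈E , trans load-sym (trans tight (c-sym u v))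
    where
    load-sym : load v u ≡ load u v
    load-sym = ΣS-cong λ S → cong (λ cut → if cut then y S else 0ℚ) (sepd-swap S v u)

  Conn-sym : Conn u v → Conn v u
  Conn-sym = Star.reverse Tight-sym

  component-closed : IsComponent C → u ∈ C → Conn u v → v ∈ C
  component-closed (w , C≡[w]) u∈C u~v = proj₂ (C≡[w] _) (proj₁ (C≡[w] _) u∈C ◅◅ u~v)

  component-connected : IsComponent C → u ∈ C → v ∈ C → Conn u v
  component-connected (w , C≡[w]) u∈C v∈C = Conn-sym (proj₁ (C≡[w] _) u∈C) ◅◅ proj₁ (C≡[w] _) v∈C

  component-inhabited : IsComponent C → ∃ (_∈ C)
  component-inhabited (w , C≡[w]) = w , proj₂ (C≡[w] w) ε

  component-uncut : IsComponent C → Tight u v → sepd I C (u , v) ≡ false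
  component-uncut C-comp uv =
    sepd-false⁺ (λ u∈C → component-closed C-comp u∈C (uv ◅ ε))
                (λ v∈C → component-closed C-comp v∈C (Tight-sym uv ◅ ε))

  active⇒component : Active C → IsComponent C
  active⇒component (inj₁ (C-comp , _)) = C-comp
  active⇒component (inj₂ (C-comp , _)) = C-comp

  tight-cut⇒inactive : Tight u v → sepd I S (u , v) ≡ true → ¬ Active S
  tight-cut⇒inactive uv cut S-active =
    case trans (sym (component-uncut (active⇒component S-active) uv)) cut of λ ()

module Dynamics (I : Instance) (R : Run I) where
  open Run R
  module At (t : ℚ) = AtState I (ya t) (yb t)
  module Props (t : ℚ) = StateProperties I (ya t) (yb t)
  open At using (y; Tight; Conn; IsComponent)

  private
    variable
      i j : ℕ
      t₁ t₂ : ℚ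

  tight-transfer : (∀ S → sepd I S (u , v) ≡ true → y t₁ S ≡ y t₂ S) → Tight t₁ u v → Tight t₂ u v
  tight-transfer {u} {v} {t₁} {t₂} frozen (uv∈E , tight) = uv∈E , trans (ΣS-cong load≡) tight
    where
    load≡ : ∀ S → (if sepd I S (u , v) then y t₂ S else 0ℚ)
                ≡ (if sepd I S (u , v) then y t₁ S else 0ℚ)
    load≡ S with sepd I S (u , v) in cut
    ... | true  = sym (frozen S cut)
    ... | false = refl

  y-frozen-in-interval : ∀ {t S} → i <ℕ k → ra i S ≡ 0ℚ → rb i S ≡ 0ℚ →
                         ts i ≤ t → t ≤ ts (suc i) → y t S ≡ y (ts i) S
  y-frozen-in-interval {i} {t} {S} i<k ra≡0 rb≡0 ts≤t t≤ts =
    cong₂ _+_ (trans (lin-a i i<k t ts≤t t≤ts S) (no-drift ra≡0 (ya (ts i) S) (t - ts i)))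
              (trans (lin-b i i<k t ts≤t t≤ts S) (no-drift rb≡0 (yb (ts i) S) (t - ts i)))
    where
    no-drift : ∀ {r} → r ≡ 0ℚ → ∀ x₀ s → x₀ + s * r ≡ x₀
    no-drift refl x₀ s = trans (cong (x₀ +_) (*-zeroʳ s)) (+-identityʳ x₀)

  tight-persists-in-interval : i <ℕ k → ts i ≤ t₁ → t₁ < ts (suc i) → t₁ ≤ t₂ → t₂ ≤ ts (suc i) →
                               Tight t₁ u v → Tight t₂ u v
  tight-persists-in-interval {i} {t₁} {t₂} i<k ts≤t₁ t₁<ts t₁≤t₂ t₂≤ts uv = tight-transfer frozen uv
    where
    frozen : ∀ S → sepd I S _ ≡ true → y t₁ S ≡ y t₂ S
    frozen S cut =
      let ra≡0 , rb≡0 = proj₂ (proj₂ (rates i i<k t₁ ts≤t₁ t₁<ts S))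
                              (Props.tight-cut⇒inactive t₁ uv cut)
      in trans (y-frozen-in-interval i<k ra≡0 rb≡0 ts≤t₁ (<⇒≤ t₁<ts))
               (sym (y-frozen-in-interval i<k ra≡0 rb≡0 (≤-trans ts≤t₁ t₁≤t₂) t₂≤ts))

  tight-persists-after-end : ts k ≤ t₁ → t₁ ≤ t₂ → Tight t₁ u v → Tight t₂ u v
  tight-persists-after-end {t₁} {t₂} end≤t₁ t₁≤t₂ = tight-transfer λ S _ →
    cong₂ _+_ (trans (final-a t₁ end≤t₁ S) (sym (final-a t₂ end≤t₂ S)))
              (trans (final-b t₁ end≤t₁ S) (sym (final-b t₂ end≤t₂ S)))
    where
    end≤t₂ : ts k ≤ t₂
    end≤t₂ = ≤-trans end≤t₁ t₁≤t₂

  tight-persists-from : j ≤‴ k → ts j ≤ t₁ → t₁ ≤ t₂ → Tight t₁ u v → Tight t₂ u v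
  tight-persists-from ≤‴-refl = tight-persists-after-end
  tight-persists-from {j} {t₁} {t₂} (≤‴-step j<k) ts≤t₁ t₁≤t₂ uv
    with ts (suc j) ≤? t₁ | t₂ ≤? ts (suc j)
  ... | yes next≤t₁ | _ = tight-persists-from j<k next≤t₁ t₁≤t₂ uv
  ... | no  t₁≱next | yes t₂≤next =
    tight-persists-in-interval (≤‴⇒≤ j<k) ts≤t₁ (≰⇒> t₁≱next) t₁≤t₂ t₂≤next uv
  ... | no  t₁≱next | no  t₂≰next =
    tight-persists-from j<k ≤-refl (<⇒≤ (≰⇒> t₂≰next))
      (tight-persists-in-interval (≤‴⇒≤ j<k) ts≤t₁ t₁<next (<⇒≤ t₁<next) ≤-refl uv)
    where
    t₁<next : t₁ < ts (suc j)
    t₁<next = ≰⇒> t₁≱next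

  tight-persists : 0ℚ ≤ t₁ → t₁ ≤ t₂ → Tight t₁ u v → Tight t₂ u v
  tight-persists 0≤t₁ = tight-persists-from 0≤‴n (subst (_≤ _) (sym ts-zero) 0≤t₁)

  conn-persists : 0ℚ ≤ t₁ → t₁ ≤ t₂ → Conn t₁ u v → Conn t₂ u v
  conn-persists 0≤t₁ t₁≤t₂ = Star.map (tight-persists 0≤t₁ t₁≤t₂)

  component-stays-connected : 0ℚ ≤ t₁ → t₁ ≤ t₂ → IsComponent t₁ A → u ∈ A → v ∈ A → Conn t₂ u v
  component-stays-connected 0≤t₁ t₁≤t₂ A-comp u∈A v∈A =
    conn-persists 0≤t₁ t₁≤t₂ (Props.component-connected _ A-comp u∈A v∈A)

  components-laminar : 0ℚ ≤ t₁ → t₁ ≤ t₂ → IsComponent t₁ A → IsComponent t₂ B →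
                       A ⊆ B ⊎ Disjoint A B
  components-laminar {t₁} {t₂} {B = B} 0≤t₁ t₁≤t₂ A-comp B-comp
    with w , w∈A ← Props.component-inhabited t₁ A-comp
    with w ∈? B
  ... | yes w∈B = inj₁ λ x∈A →
    Props.component-closed t₂ B-comp w∈B (component-stays-connected 0≤t₁ t₁≤t₂ A-comp w∈A x∈A)
  ... | no  w∉B = inj₂ λ x x∈A x∈B →
    w∉B (Props.component-closed t₂ B-comp x∈B (component-stays-connected 0≤t₁ t₁≤t₂ A-comp x∈A w∈A))

  nested-or-disjoint : ∀ {Bs} → 0ℚ ≤ t₁ → t₁ ≤ t₂ → IsComponent t₁ A → All (IsComponent t₂) Bs →
                       Any (A ⊆_) Bs ⊎ All (Disjoint A) Bs
  nested-or-disjoint 0≤t₁ t₁≤t₂ A-comp [] = inj₂ []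
  nested-or-disjoint 0≤t₁ t₁≤t₂ A-comp (B-comp ∷ Bs-comp)
    with components-laminar 0≤t₁ t₁≤t₂ A-comp B-comp | nested-or-disjoint 0≤t₁ t₁≤t₂ A-comp Bs-comp
  ... | inj₁ A⊆B | _          = inj₁ (here A⊆B)
  ... | inj₂ _   | inj₁ A⊆Bs  = inj₁ (there A⊆Bs)
  ... | inj₂ A#B | inj₂ A#Bs  = inj₂ (A#B ∷ A#Bs)

module Autarky (I : Instance) (R : Run I) where
  open Instance I using (n)
  open Separation I
  open Dynamics I R
  open CommutativeSemigroupProperties
    (CommutativeMonoid.commutativeSemigroup (∪-commutativeMonoid n))
    using (x∙yz≈y∙xz; x∙yz≈z∙xy)

  autarkic-components : ∀ P → Autarkic I R P → ∃ λ t → 0ℚ ≤ t × All (At.IsComponent t) (members I P)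
  autarkic-components (pair _ _)     (_ , _ , _ , (t , 0≤t , active) , _) =
    t , 0≤t , All.map (Props.active⇒component t) active
  autarkic-components (triple _ _ _) (_ , _ , _ , (t , 0≤t , active) , _) =
    t , 0≤t , All.map (Props.active⇒component t) active

  autarkic-SepEmpty-⋃ : ∀ P → Autarkic I R P → SepEmpty I (⋃ (members I P))
  autarkic-SepEmpty-⋃ (pair A B) (_ , _ , A#B , _ , A≡B , _) =
    subst (λ B′ → SepEmpty I (A ∪ B′)) (sym (∪-identityʳ B)) (SameSep⇒SepEmpty-∪ A#B A≡B)
  autarkic-SepEmpty-⋃ (triple A₁ A₂ A₃) (_ , _ , _ , _ , _ , _ , _ , closed) =
    subst (λ A₃′ → SepEmpty I (A₁ ∪ (A₂ ∪ A₃′))) (sym (∪-identityʳ A₃)) closed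

  module _ (Qs : List (Subset n)) (Qs-closed : SepEmpty I (⋃ Qs)) where
    Nested Separate : Subset n → Set
    Nested X   = Any (X ⊆_) Qs
    Separate X = All (Disjoint X) Qs

    private
      split : SepTwins A B → A ⊆ ⋃ Qs → Disjoint B (⋃ Qs) → ⊥
      split = twins-not-split Qs-closed

      nested-∪ : Nested A → Nested B → A ∪ B ⊆ ⋃ Qs
      nested-∪ A⊆ B⊆ = ∪-⊆ (⊆-⋃ A⊆) (⊆-⋃ B⊆)

      separate-∪ : Separate A → Separate B → Disjoint (A ∪ B) (⋃ Qs)
      separate-∪ A# B# = ∪-disjoint (disjoint-⋃ A#) (disjoint-⋃ B#)

    OneSided : List (Subset n) → Set
    OneSided Ps = All (λ X → Nested X ⊎ Separate X) Ps → All Nested Ps ⊎ All Separate Ps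

    twins-one-sided : SepTwins A B → OneSided (A ∷ B ∷ [])
    twins-one-sided twins (inj₁ A⊆ ∷ inj₁ B⊆ ∷ []) = inj₁ (A⊆ ∷ B⊆ ∷ [])
    twins-one-sided twins (inj₂ A# ∷ inj₂ B# ∷ []) = inj₂ (A# ∷ B# ∷ [])
    twins-one-sided twins (inj₁ A⊆ ∷ inj₂ B# ∷ []) = ⊥-elim (split twins (⊆-⋃ A⊆) (disjoint-⋃ B#))
    twins-one-sided twins (inj₂ A# ∷ inj₁ B⊆ ∷ []) =
      ⊥-elim (split (SepTwins-sym twins) (⊆-⋃ B⊆) (disjoint-⋃ A#))

    triple-one-sided : SepTwins A₁ (A₂ ∪ A₃) → SepTwins A₂ (A₁ ∪ A₃) → SepTwins A₃ (A₁ ∪ A₂) →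
                       OneSided (A₁ ∷ A₂ ∷ A₃ ∷ [])
    triple-one-sided tw₁ tw₂ tw₃ = λ where
      (inj₁ s₁ ∷ inj₁ s₂ ∷ inj₁ s₃ ∷ []) → inj₁ (s₁ ∷ s₂ ∷ s₃ ∷ [])
      (inj₂ s₁ ∷ inj₂ s₂ ∷ inj₂ s₃ ∷ []) → inj₂ (s₁ ∷ s₂ ∷ s₃ ∷ [])
      (inj₁ s₁ ∷ inj₂ s₂ ∷ inj₂ s₃ ∷ []) → ⊥-elim (split tw₁ (⊆-⋃ s₁) (separate-∪ s₂ s₃))
      (inj₂ s₁ ∷ inj₁ s₂ ∷ inj₁ s₃ ∷ []) →
        ⊥-elim (split (SepTwins-sym tw₁) (nested-∪ s₂ s₃) (disjoint-⋃ s₁))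
      (inj₂ s₁ ∷ inj₁ s₂ ∷ inj₂ s₃ ∷ []) → ⊥-elim (split tw₂ (⊆-⋃ s₂) (separate-∪ s₁ s₃))
      (inj₁ s₁ ∷ inj₂ s₂ ∷ inj₁ s₃ ∷ []) →
        ⊥-elim (split (SepTwins-sym tw₂) (nested-∪ s₁ s₃) (disjoint-⋃ s₂))
      (inj₂ s₁ ∷ inj₂ s₂ ∷ inj₁ s₃ ∷ []) → ⊥-elim (split tw₃ (⊆-⋃ s₃) (separate-∪ s₁ s₂))
      (inj₁ s₁ ∷ inj₁ s₂ ∷ inj₂ s₃ ∷ []) →
        ⊥-elim (split (SepTwins-sym tw₃) (nested-∪ s₁ s₂) (disjoint-⋃ s₃))

    autarkic-one-sided : ∀ P → Autarkic I R P → OneSided (members I P)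
    autarkic-one-sided (pair A B) (_ , _ , A#B , _ , A≡B , A-sep) =
      twins-one-sided (A#B , A≡B , A-sep)
    autarkic-one-sided (triple A₁ A₂ A₃) (A₁#A₂ , A₁#A₃ , A₂#A₃ , _ , A₁-sep , A₂-sep , A₃-sep , closed) =
      triple-one-sided
        (triple-twins A₁#A₂ A₁#A₃ closed A₁-sep)
        (triple-twins (Disjoint-sym A₁#A₂) A₂#A₃ closed₂ A₂-sep)
        (triple-twins (Disjoint-sym A₁#A₃) (Disjoint-sym A₂#A₃) closed₃ A₃-sep)
      where
      closed₂ : SepEmpty I (A₂ ∪ (A₁ ∪ A₃))
      closed₂ = subst (SepEmpty I) (x∙yz≈y∙xz A₁ A₂ A₃) closed
      closed₃ : SepEmpty I (A₃ ∪ (A₁ ∪ A₂))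
      closed₃ = subst (SepEmpty I) (x∙yz≈z∙xy A₁ A₂ A₃) closed

  earlier-nested-or-disjoint : ∀ P Q {tP tQ} → Autarkic I R P → SepEmpty I (⋃ (members I Q)) →
    0ℚ ≤ tP → tP ≤ tQ →
    All (At.IsComponent tP) (members I P) → All (At.IsComponent tQ) (members I Q) →
    _⊆T_ I P Q ⊎ DisjointT I P Q
  earlier-nested-or-disjoint P Q P-aut Q-closed 0≤tP tP≤tQ P-comps Q-comps =
    autarkic-one-sided (members I Q) Q-closed P P-aut
      (All.map (λ A-comp → nested-or-disjoint 0≤tP tP≤tQ A-comp Q-comps) P-comps)

open Autarky using (autarkic-components; autarkic-SepEmpty-⋃; earlier-nested-or-disjoint)

DisjointT-sym : ∀ I {P Q} → DisjointT I P Q → DisjointT I Q P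
DisjointT-sym I = All.map (All.map Disjoint-sym) ∘ All-swap

lemma4p10 : (I : Instance) (R : Run I) (P Q : Tuple I) →
    Autarkic I R P → Autarkic I R Q →
    _⊆T_ I P Q ⊎ _⊆T_ I Q P ⊎ DisjointT I P Q
lemma4p10 I R P Q P-aut Q-aut
  with tP , 0≤tP , P-comps ← autarkic-components I R P P-aut
     | tQ , 0≤tQ , Q-comps ← autarkic-components I R Q Q-aut
  with ≤-total tP tQ
... | inj₁ tP≤tQ = Sum.map₂ inj₂
  (earlier-nested-or-disjoint I R P Q P-aut (autarkic-SepEmpty-⋃ I R Q Q-aut)
                              0≤tP tP≤tQ P-comps Q-comps)
... | inj₂ tQ≤tP = [ inj₂ ∘ inj₁ , inj₂ ∘ inj₂ ∘ DisjointT-sym I ]′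
  (earlier-nested-or-disjoint I R Q P Q-aut (autarkic-SepEmpty-⋃ I R P P-aut)
                              0≤tQ tQ≤tP Q-comps P-comps)
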